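{- Let $\mathbf c=(c_1,\dots,c_m)$ and $\mathbf d=(d_1,\dots,d_n)$ be IP sequences, $l=\max\{m,n\}$ and $h=\max\{c_m,d_n\}$. Let $\mathcal A\subseteq\mathcal L_{\mathbf c}^{(\le m)}$ and $\mathcal B\subseteq\mathcal L_{\mathbf d}^{(\le n)}$ be cross-intersecting. Let \[\mathcal A^*=\Gamma_{l,h}\circ\dots\circ\Gamma_{l,2}\circ\dots\circ\Gamma_{2,h}\circ\dots\circ\Gamma_{2,2}\circ\Gamma_{1,h}\circ\dots\circ\Gamma_{1,2}(\mathcal A),\] \[\mathcal B^*=\Gamma_{l,h}\circ\dots\circ\Gamma_{l,2}\circ\dots\circ\Gamma_{2,h}\circ\dots\circ\Gamma_{2,2}\circ\Gamma_{1,h}\circ\dots\circ\Gamma_{1,2}(\mathcal B)\] (that is, the operations $\Gamma_{x,y}$ for $x\in[l]$, $y\in[2,h]$ are applied in lexicographic order of $(x,y)$, starting with $\Gamma_{1,2}$). Then $A\cap B\cap([l]\times[1])\ne\emptyset$ for any $A\in\mathcal A^*$ and any $B\in\mathcal B^*$.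
   Context: An IP sequence is $(c_1,\dots,c_n)$ with $1\le c_1\le\dots\le c_n$ integers. $[a,b]=\{i\in\mathbb N\colon a\le i\le b\}$, $[k]=[1,k]$. For an IP sequence $\mathbf c=(c_1,\dots,c_n)$ and integer $r$, $\mathcal L_{\mathbf c}^{(r)}=\{\{(i_1,a_{i_1}),\dots,(i_r,a_{i_r})\}\colon\{i_1,\dots,i_r\}\text{ an }r\text{ -subset of }[n],\ a_{i_j}\in[c_{i_j}]\}$, and $\mathcal L_{\mathbf c}^{(\le r)}=\bigcup_{i=1}^r\mathcal L_{\mathbf c}^{(i)}$. Families are cross-intersecting if every member of one intersects every member of the other. For $x,y\in\mathbb N$ and a set $A$ of pairs, $\gamma_{x,y}(A)=(A\setminus\{(x,y)\})\cup\{(x,1)\}$ if $(x,y)\in A$, and $A$ otherwise; $\Gamma_{x,y}(\mathcal A)=\{\gamma_{x,y}(A)\colon A\in\mathcal A,\ \gamma_{x,y}(A)\notin\mathcal A\}\cup\{A\in\mathcal A\colon\gamma_{x,y}(A)\in\mathcal A\}$. -}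

module Defs where

open import Data.Nat using (ℕ; zero; suc; _+_; _∸_; _≤_; _⊔_)
open import Data.Nat.Properties using (_≟_)
open import Data.Bool using (Bool; true; false; if_then_else_; _∧_; not)
open import Data.List using (List; []; _∷_; map; upTo; concatMap; foldl; filter; length; deduplicate)
open import Data.Bool.ListAction using (any; all)
open import Data.List.Membership.Propositional using (_∈_)
open import Data.List.Relation.Unary.All using (All)
open import Data.Product using (_×_; _,_; ∃; Σ)
open import Data.Product.Properties using (≡-dec)
open import Relation.Nullary using (¬_; Dec; yes; no)
open import Relation.Nullary.Decidable using (⌊_⌋)
open import Relation.Binary.PropositionalEquality using (_≡_; _≢_)
open import Data.List.Relation.Unary.Sorted.TotalOrder using (Sorted)
open import Data.Nat.Properties using (≤-totalOrder)

-- A pair (i , a) ∈ ℕ × ℕ ; a "set of pairs" is a finite set, represented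
-- by a list (order and repetitions irrelevant; membership is list membership).
Pair : Set
Pair = ℕ × ℕ

PSet : Set
PSet = List Pair

-- A family of sets of pairs, again a finite set represented by a list;
-- membership of a set in a family is taken up to set equality (see _∈ᶠ_).
Family : Set
Family = List PSet

_≟ₚ_ : (p q : Pair) → Dec (p ≡ q)
_≟ₚ_ = ≡-dec _≟_ _≟_

memᵇ : Pair → PSet → Bool
memᵇ p A = any (λ q → ⌊ q ≟ₚ p ⌋) A

subᵇ : PSet → PSet → Bool
subᵇ A B = all (λ p → memᵇ p B) A

eqᵇ : PSet → PSet → Bool
eqᵇ A B = subᵇ A B ∧ subᵇ B A

inFamᵇ : PSet → Family → Bool
inFamᵇ A 𝒜 = any (λ A' → eqᵇ A' A) 𝒜

γ : ℕ → ℕ → PSet → PSet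
γ x y A = if memᵇ (x , y) A
          then (x , 1) ∷ filter (λ p → ¬? (p ≟ₚ (x , y))) A
          else A
  where
    open import Relation.Nullary.Decidable using (¬?)

-- Γ_{x,y}(𝒜) = {γ(A) : A ∈ 𝒜, γ(A) ∉ 𝒜} ∪ {A ∈ 𝒜 : γ(A) ∈ 𝒜}
Γ : ℕ → ℕ → Family → Family
Γ x y 𝒜 = map (λ A → if inFamᵇ (γ x y A) 𝒜 then A else γ x y A) 𝒜

interval : ℕ → ℕ → List ℕ
interval a b = map (a +_) (upTo (suc b ∸ a))

shiftOrder : ℕ → ℕ → List Pair
shiftOrder l h = concatMap (λ x → map (x ,_) (interval 2 h)) (interval 1 l)

-- apply Γ_{x,y} for (x , y) in lexicographic order, starting with Γ_{1,2}
-- (so the result is Γ_{l,h} ∘ … ∘ Γ_{1,2} (𝒜))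
shiftAll : ℕ → ℕ → Family → Family
shiftAll l h 𝒜 = foldl (λ ℱ p → Γ (Data.Product.proj₁ p) (Data.Product.proj₂ p) ℱ) 𝒜 (shiftOrder l h)
  where import Data.Product

-- 1-based indexing of a sequence: nth c i = c_i (0 outside [1 , length c])
nth : List ℕ → ℕ → ℕ
nth [] _ = 0
nth (x ∷ c) zero = 0
nth (x ∷ c) (suc zero) = x
nth (x ∷ c) (suc (suc i)) = nth c (suc i)

IP : List ℕ → Set
IP c = (c ≢ []) × All (1 ≤_) c × Sorted ≤-totalOrder c

card : PSet → ℕ
card A = length (deduplicate _≟ₚ_ A)

-- A ∈ L_c^{(r)}: A = {(i_1,a_{i_1}),…,(i_r,a_{i_r})} with {i_1,…,i_r} an
-- r-subset of [n] (n = length c) and a_{i_j} ∈ [c_{i_j}]; i.e. A has r elements,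
-- with pairwise distinct first coordinates in [n] and second coordinates in [c_i].
inL : List ℕ → ℕ → PSet → Set
inL c r A =
    card A ≡ r
  × (∀ i a → (i , a) ∈ A → (1 ≤ i × i ≤ length c) × (1 ≤ a × a ≤ nth c i))
  × (∀ i a a' → (i , a) ∈ A → (i , a') ∈ A → a ≡ a')

inL≤ : List ℕ → ℕ → PSet → Set
inL≤ c r A = Σ ℕ λ i → (1 ≤ i × i ≤ r) × inL c i A

CrossIntersecting : Family → Family → Set
CrossIntersecting 𝒜 ℬ = ∀ A B → A ∈ 𝒜 → B ∈ ℬ → ∃ λ p → p ∈ A × p ∈ B

-- A shift Γ x y with y ≢ 1 keeps cross-intersecting families cross-intersecting, provided
-- their members meet each row at most once, and leaves the family closed under γ x y (up to
-- set equality); later shifts Γ x' y' preserve that closure. Hence 𝒜* is closed under γ x a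
-- for every point (x , a) of its members off level one. Given A ∈ 𝒜* and B ∈ ℬ*, push every
-- point of A ∩ B off level one down to level one: the result lies in 𝒜*, so it still meets B,
-- and since B meets each row at most once it can only do so at a point (x , 1) of A ∩ B.
module Submission where

open import Defs
open import Data.Bool using (Bool; true; false; if_then_else_)
open import Data.Bool.ListAction using (any; all)
open import Data.Empty using (⊥-elim)
open import Data.List using (List; []; _∷_; length; map; filter; foldl)
open import Data.List.Membership.Propositional using (_∈_; _∉_; find; lose)
open import Data.List.Membership.Propositional.Properties
  using (∈-filter⁺; ∈-filter⁻; ∈-map⁺; ∈-map⁻; ∈-upTo⁺; ∈-concat⁺′; ∈-concat⁻′)
open import Data.List.Membership.DecPropositional _≟ₚ_ using (_∈?_)
open import Data.List.Relation.Binary.Subset.Propositional using (_⊆_)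
open import Data.List.Relation.Binary.Subset.Propositional.Properties using (⊆-refl; ⊆-trans)
open import Data.List.Relation.Unary.All as All using (All; _∷_)
open import Data.List.Relation.Unary.All.Properties as Allₚ using ()
open import Data.List.Relation.Unary.Any as Any using (Any; here; there)
open import Data.List.Relation.Unary.Linked using (_∷_)
open import Data.List.Relation.Unary.Sorted.TotalOrder using (Sorted)
open import Data.Nat using (ℕ; zero; suc; _+_; _≤_; _⊔_; s≤s; z≤n)
open import Data.Nat.Properties
  using (_≟_; ≤-refl; ≤-trans; ≤-totalOrder; m≤m⊔n; m≤m+n; m+[n∸m]≡n; ∸-monoˡ-<;
         ≤∧≢⇒<; >⇒≢)
open import Data.Product using (_×_; _,_; proj₁; proj₂; ∃; ∃₂)
open import Data.Sum using (_⊎_; inj₁; inj₂)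
open import Function using (_∘_; id)
open import Relation.Nullary using (¬_; yes; no)
open import Relation.Nullary.Decidable using (⌊_⌋; ¬?; _×-dec_)
open import Relation.Nullary.Reflects using (Reflects; ofʸ; ofⁿ; _×-reflects_; _⊎-reflects_)
open import Relation.Binary.PropositionalEquality using (_≡_; _≢_; refl; sym; cong; subst)
open import Relation.Unary using (∅; _∪_)

variable
  a b i x y x' y' : ℕ
  p : Pair
  A B C : PSet
  ℱ 𝒢 : Family
  c : List ℕ

map-reflects : ∀ {P Q : Set} {b} → (P → Q) → (Q → P) → Reflects P b → Reflects Q b
map-reflects f g (ofʸ p) = ofʸ (f p)
map-reflects f g (ofⁿ ¬p) = ofⁿ (¬p ∘ g)

any-reflects : ∀ {X : Set} {P : X → Set} {f : X → Bool} →
  (∀ x → Reflects (P x) (f x)) → ∀ xs → Reflects (Any P xs) (any f xs)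
any-reflects r [] = ofⁿ λ ()
any-reflects r (x ∷ xs) = map-reflects Any.fromSum Any.toSum (r x ⊎-reflects any-reflects r xs)

all-reflects : ∀ {X : Set} {P : X → Set} {f : X → Bool} →
  (∀ x → Reflects (P x) (f x)) → ∀ xs → Reflects (All P xs) (all f xs)
all-reflects r [] = ofʸ All.[]
all-reflects r (x ∷ xs) =
  map-reflects (λ (px , pxs) → px ∷ pxs) All.uncons (r x ×-reflects all-reflects r xs)

memᵇ-reflects : ∀ p A → Reflects (p ∈ A) (memᵇ p A)
memᵇ-reflects p = any-reflects ≡p-reflects
  where
    ≡p-reflects : ∀ q → Reflects (p ≡ q) ⌊ q ≟ₚ p ⌋
    ≡p-reflects q with q ≟ₚ p
    ... | yes refl = ofʸ refl
    ... | no q≢p = ofⁿ (q≢p ∘ sym)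

_≐_ : PSet → PSet → Set
A ≐ B = A ⊆ B × B ⊆ A

≐-refl : A ≐ A
≐-refl = ⊆-refl , ⊆-refl

≐-sym : A ≐ B → B ≐ A
≐-sym (A⊆B , B⊆A) = B⊆A , A⊆B

≐-trans : A ≐ B → B ≐ C → A ≐ C
≐-trans (A⊆B , B⊆A) (B⊆C , C⊆B) = ⊆-trans A⊆B B⊆C , ⊆-trans C⊆B B⊆A

eqᵇ-reflects : ∀ A B → Reflects (A ≐ B) (eqᵇ A B)
eqᵇ-reflects A B = subᵇ-reflects A B ×-reflects subᵇ-reflects B A
  where
    subᵇ-reflects : ∀ A B → Reflects (A ⊆ B) (subᵇ A B)
    subᵇ-reflects A B =
      map-reflects All.lookup All.tabulate (all-reflects (λ p → memᵇ-reflects p B) A)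

_∈ᶠ_ : PSet → Family → Set
A ∈ᶠ ℱ = ∃ λ A' → A' ∈ ℱ × A' ≐ A

∈⇒∈ᶠ : A ∈ ℱ → A ∈ᶠ ℱ
∈⇒∈ᶠ A∈ℱ = _ , A∈ℱ , ≐-refl

∈ᶠ-resp-≐ : A ∈ᶠ ℱ → A ≐ B → B ∈ᶠ ℱ
∈ᶠ-resp-≐ (A' , A'∈ℱ , A'≐A) A≐B = A' , A'∈ℱ , ≐-trans A'≐A A≐B

inFamᵇ-reflects : ∀ A ℱ → Reflects (A ∈ᶠ ℱ) (inFamᵇ A ℱ)
inFamᵇ-reflects A ℱ =
  map-reflects find (λ (_ , A'∈ℱ , A'≐A) → lose A'∈ℱ A'≐A)
    (any-reflects (λ A' → eqᵇ-reflects A' A) ℱ)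

γ-∈⁻ : p ∈ γ x y A → (p ≡ (x , 1) × (x , y) ∈ A) ⊎ (p ∈ A × p ≢ (x , y))
γ-∈⁻ {x = x} {y = y} {A = A} p∈γA with memᵇ (x , y) A | memᵇ-reflects (x , y) A
γ-∈⁻ (here refl) | true | ofʸ xy∈A = inj₁ (refl , xy∈A)
γ-∈⁻ (there p∈) | true | ofʸ _ = inj₂ (∈-filter⁻ _ p∈)
γ-∈⁻ p∈A | false | ofⁿ xy∉A = inj₂ (p∈A , λ { refl → xy∉A p∈A })

γ-shifted : (x , y) ∈ A → (x , 1) ∈ γ x y A
γ-shifted {x = x} {y = y} {A = A} xy∈A with memᵇ (x , y) A | memᵇ-reflects (x , y) A
... | true | _ = here refl
... | false | ofⁿ xy∉A = ⊥-elim (xy∉A xy∈A)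

γ-kept : p ∈ A → p ≢ (x , y) → p ∈ γ x y A
γ-kept {A = A} {x = x} {y = y} p∈A p≢xy with memᵇ (x , y) A
... | true = there (∈-filter⁺ _ p∈A p≢xy)
... | false = p∈A

γ-unmoved : (x , y) ∉ A → γ x y A ≐ A
γ-unmoved {x = x} {y = y} {A = A} xy∉A with memᵇ (x , y) A | memᵇ-reflects (x , y) A
... | true | ofʸ xy∈A = ⊥-elim (xy∉A xy∈A)
... | false | _ = ≐-refl

γ-at-one : (x , 1) ∈ A → γ x 1 A ≐ A
γ-at-one {x = x} {A = A} x1∈A = γA⊆A , A⊆γA
  where
    γA⊆A : γ x 1 A ⊆ A
    γA⊆A p∈ with γ-∈⁻ {A = A} p∈
    ... | inj₁ (refl , _) = x1∈A
    ... | inj₂ (p∈A , _) = p∈A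
    A⊆γA : A ⊆ γ x 1 A
    A⊆γA {p} p∈A with p ≟ₚ (x , 1)
    ... | yes refl = γ-shifted x1∈A
    ... | no p≢x1 = γ-kept p∈A p≢x1

γ-removes : y ≢ 1 → (x , y) ∉ γ x y A
γ-removes {A = A} y≢1 xy∈γA with γ-∈⁻ {A = A} xy∈γA
... | inj₁ (refl , _) = y≢1 refl
... | inj₂ (_ , xy≢xy) = xy≢xy refl

γ-∉ : p ∉ A → p ≢ (x , 1) → p ∉ γ x y A
γ-∉ {A = A} p∉A p≢x1 p∈γA with γ-∈⁻ {A = A} p∈γA
... | inj₁ (p≡x1 , _) = p≢x1 p≡x1
... | inj₂ (p∈A , _) = p∉A p∈A

γ-mono : A ⊆ B → γ x y A ⊆ γ x y B
γ-mono {A = A} A⊆B p∈ with γ-∈⁻ {A = A} p∈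
... | inj₁ (refl , xy∈A) = γ-shifted (A⊆B xy∈A)
... | inj₂ (p∈A , p≢xy) = γ-kept (A⊆B p∈A) p≢xy

γ-cong : A ≐ B → γ x y A ≐ γ x y B
γ-cong (A⊆B , B⊆A) = γ-mono A⊆B , γ-mono B⊆A

γ-comm⊆ : x ≢ x' → γ x y (γ x' y' A) ⊆ γ x' y' (γ x y A)
γ-comm⊆ {x = x} {x' = x'} {y = y} {y' = y'} {A = A} x≢x' p∈
  with γ-∈⁻ {x = x} {y = y} {A = γ x' y' A} p∈
... | inj₁ (refl , xy∈γ'A) with γ-∈⁻ {A = A} xy∈γ'A
...   | inj₁ (refl , _) = ⊥-elim (x≢x' refl)
...   | inj₂ (xy∈A , _) = γ-kept (γ-shifted xy∈A) (x≢x' ∘ cong proj₁)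
γ-comm⊆ {A = A} x≢x' p∈ | inj₂ (p∈γ'A , p≢xy) with γ-∈⁻ {A = A} p∈γ'A
...   | inj₁ (refl , x'y'∈A) = γ-shifted (γ-kept x'y'∈A (x≢x' ∘ sym ∘ cong proj₁))
...   | inj₂ (p∈A , p≢x'y') = γ-kept (γ-kept p∈A p≢xy) p≢x'y'

γ-comm : x ≢ x' → γ x y (γ x' y' A) ≐ γ x' y' (γ x y A)
γ-comm {y = y} {y' = y'} {A = A} x≢x' =
  γ-comm⊆ {y = y} {y' = y'} {A = A} x≢x' , γ-comm⊆ {y = y'} {y' = y} {A = A} (x≢x' ∘ sym)

Functional : PSet → Set
Functional A = ∀ {i a b} → (i , a) ∈ A → (i , b) ∈ A → a ≡ b

distinct-rows : Functional A → (x , y) ∈ A → (x' , y') ∈ A → (x , y) ≢ (x' , y') → x ≢ x'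
distinct-rows fun xy∈A x'y'∈A xy≢x'y' refl with fun xy∈A x'y'∈A
... | refl = xy≢x'y' refl

γ-functional : Functional A → Functional (γ x y A)
γ-functional {A = A} fun p∈ q∈ with γ-∈⁻ {A = A} p∈ | γ-∈⁻ {A = A} q∈
... | inj₁ (refl , _) | inj₁ (refl , _) = refl
... | inj₁ (refl , xy∈A) | inj₂ (q∈A , q≢xy) = ⊥-elim (q≢xy (cong (_ ,_) (sym (fun xy∈A q∈A))))
... | inj₂ (p∈A , p≢xy) | inj₁ (refl , xy∈A) = ⊥-elim (p≢xy (cong (_ ,_) (sym (fun xy∈A p∈A))))
... | inj₂ (p∈A , _) | inj₂ (q∈A , _) = fun p∈A q∈A

Bounded : List ℕ → PSet → Set
Bounded c A = ∀ {i a} → (i , a) ∈ A → (1 ≤ i × i ≤ length c) × (1 ≤ a × a ≤ nth c i)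

γ-bounded : Bounded c A → Bounded c (γ x y A)
γ-bounded {A = A} bounded p∈ with γ-∈⁻ {A = A} p∈
... | inj₁ (refl , xy∈A) = let row , 1≤y , y≤c = bounded xy∈A in row , s≤s z≤n , ≤-trans 1≤y y≤c
... | inj₂ (p∈A , _) = bounded p∈A

Γ-∈⁺ : A ∈ ℱ → (if inFamᵇ (γ x y A) ℱ then A else γ x y A) ∈ Γ x y ℱ
Γ-∈⁺ = ∈-map⁺ _

Γ-keeps : A ∈ ℱ → γ x y A ∈ᶠ ℱ → A ∈ Γ x y ℱ
Γ-keeps {A = A} {ℱ = ℱ} {x = x} {y = y} A∈ℱ γA∈ℱ
  with inFamᵇ (γ x y A) ℱ | inFamᵇ-reflects (γ x y A) ℱ | Γ-∈⁺ {x = x} {y = y} A∈ℱ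
... | true | _ | A∈Γℱ = A∈Γℱ
... | false | ofⁿ γA∉ℱ | _ = ⊥-elim (γA∉ℱ γA∈ℱ)

Γ-moves : A ∈ ℱ → ¬ γ x y A ∈ᶠ ℱ → γ x y A ∈ Γ x y ℱ
Γ-moves {A = A} {ℱ = ℱ} {x = x} {y = y} A∈ℱ γA∉ℱ
  with inFamᵇ (γ x y A) ℱ | inFamᵇ-reflects (γ x y A) ℱ | Γ-∈⁺ {x = x} {y = y} A∈ℱ
... | true | ofʸ γA∈ℱ | _ = ⊥-elim (γA∉ℱ γA∈ℱ)
... | false | _ | γA∈Γℱ = γA∈Γℱ

Γ-∈⁻ : B ∈ Γ x y ℱ →
  ∃ λ A → A ∈ ℱ × ((γ x y A ∈ᶠ ℱ × B ≡ A) ⊎ (¬ γ x y A ∈ᶠ ℱ × B ≡ γ x y A))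
Γ-∈⁻ {x = x} {y = y} {ℱ = ℱ} B∈ with ∈-map⁻ _ B∈
... | A , A∈ℱ , refl with inFamᵇ (γ x y A) ℱ | inFamᵇ-reflects (γ x y A) ℱ
...   | true | ofʸ γA∈ℱ = A , A∈ℱ , inj₁ (γA∈ℱ , refl)
...   | false | ofⁿ γA∉ℱ = A , A∈ℱ , inj₂ (γA∉ℱ , refl)

moved⇒∈ : A ∈ ℱ → ¬ γ x y A ∈ᶠ ℱ → (x , y) ∈ A
moved⇒∈ {A = A} {x = x} {y = y} A∈ℱ γA∉ℱ with (x , y) ∈? A
... | yes xy∈A = xy∈A
... | no xy∉A = ⊥-elim (γA∉ℱ (∈ᶠ-resp-≐ (∈⇒∈ᶠ A∈ℱ) (≐-sym (γ-unmoved xy∉A))))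

Γ-unmoved : A ∈ ℱ → (x , y) ∉ A → A ∈ᶠ Γ x y ℱ
Γ-unmoved {A = A} {ℱ = ℱ} {x = x} {y = y} A∈ℱ xy∉A
  with inFamᵇ (γ x y A) ℱ | Γ-∈⁺ {x = x} {y = y} A∈ℱ
... | true | A∈Γℱ = ∈⇒∈ᶠ A∈Γℱ
... | false | γA∈Γℱ = _ , γA∈Γℱ , γ-unmoved xy∉A

Γ-image : y ≢ 1 → A ∈ ℱ → γ x y A ∈ᶠ Γ x y ℱ
Γ-image {y = y} {A = A} {ℱ = ℱ} {x = x} y≢1 A∈ℱ
  with inFamᵇ (γ x y A) ℱ | inFamᵇ-reflects (γ x y A) ℱ | Γ-∈⁺ {x = x} {y = y} A∈ℱ
... | true | ofʸ (D , D∈ℱ , D≐γA) | _ =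
  ∈ᶠ-resp-≐ (Γ-unmoved D∈ℱ (γ-removes {A = A} y≢1 ∘ proj₁ D≐γA)) D≐γA
... | false | _ | γA∈Γℱ = ∈⇒∈ᶠ γA∈Γℱ

Γ-preserves : ∀ {P : PSet → Set} → (∀ {A} → P A → P (γ x y A)) → All P ℱ → All P (Γ x y ℱ)
Γ-preserves {x = x} {y = y} {ℱ = ℱ} {P = P} γ-pres =
  Allₚ.map⁺ ∘ All.map (λ {A} → choose (inFamᵇ (γ x y A) ℱ))
  where
    choose : ∀ {A} b → P A → P (if b then A else γ x y A)
    choose true PA = PA
    choose false PA = γ-pres PA

Stable : ℕ → ℕ → Family → Set
Stable x y ℱ = ∀ {A} → A ∈ ℱ → (x , y) ∈ A → γ x y A ∈ᶠ ℱ

Stable-∈ᶠ : Stable x y ℱ → A ∈ᶠ ℱ → γ x y A ∈ᶠ ℱ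
Stable-∈ᶠ {x = x} {y = y} stable (D , D∈ℱ , D≐A) with (x , y) ∈? D
... | yes xy∈D = ∈ᶠ-resp-≐ (stable D∈ℱ xy∈D) (γ-cong D≐A)
... | no xy∉D = D , D∈ℱ , ≐-trans (≐-sym (γ-unmoved xy∉D)) (γ-cong D≐A)

Γ-stable : y ≢ 1 → Stable x y (Γ x y ℱ)
Γ-stable {ℱ = ℱ} y≢1 B∈ xy∈B with Γ-∈⁻ {ℱ = ℱ} B∈
... | A , A∈ℱ , inj₁ (_ , refl) = Γ-image y≢1 A∈ℱ
... | A , A∈ℱ , inj₂ (_ , refl) = ⊥-elim (γ-removes {A = A} y≢1 xy∈B)

Γ-stable-kept : All Functional ℱ → y' ≢ 1 → Stable x y ℱ →
                A ∈ ℱ → γ x' y' A ∈ᶠ ℱ → (x , y) ∈ A → γ x y A ∈ᶠ Γ x' y' ℱ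
Γ-stable-kept {ℱ = ℱ} {y' = y'} {x = x} {y = y} {A = A} {x' = x'}
              fun y'≢1 stable A∈ℱ γ'A∈ℱ xy∈A
  with (x , y) ≟ₚ (x' , y') | (x' , y') ∈? A | stable A∈ℱ xy∈A
... | yes refl | _ | _ = Γ-image y'≢1 A∈ℱ
... | no _ | no x'y'∉A | C , C∈ℱ , C≐γA =
  ∈ᶠ-resp-≐ (Γ-unmoved C∈ℱ (γ-∉ x'y'∉A (y'≢1 ∘ cong proj₂) ∘ proj₁ C≐γA)) C≐γA
... | no xy≢x'y' | yes x'y'∈A | C , C∈ℱ , C≐γA = C , Γ-keeps C∈ℱ γ'C∈ℱ , C≐γA
  where
    x≢x' : x ≢ x'
    x≢x' = distinct-rows (All.lookup fun A∈ℱ) xy∈A x'y'∈A xy≢x'y'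
    γ'C∈ℱ : γ x' y' C ∈ᶠ ℱ
    γ'C∈ℱ = ∈ᶠ-resp-≐ (Stable-∈ᶠ stable γ'A∈ℱ)
                      (≐-trans (γ-comm {A = A} x≢x') (γ-cong (≐-sym C≐γA)))

Γ-stable-moved : All Functional ℱ → y' ≢ 1 → Stable x y ℱ →
                 A ∈ ℱ → ¬ γ x' y' A ∈ᶠ ℱ → (x , y) ∈ γ x' y' A →
                 γ x y (γ x' y' A) ∈ᶠ Γ x' y' ℱ
Γ-stable-moved {y' = y'} {x = x} {y = y} {A = A} {x' = x'} fun y'≢1 stable A∈ℱ γ'A∉ℱ xy∈γ'A
  with γ-∈⁻ {A = A} xy∈γ'A
... | inj₁ (refl , _) = _ , Γ-moves A∈ℱ γ'A∉ℱ , ≐-sym (γ-at-one xy∈γ'A)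
... | inj₂ (xy∈A , xy≢x'y') with stable A∈ℱ xy∈A
...   | C , C∈ℱ , C≐γA =
  ∈ᶠ-resp-≐ (Γ-image y'≢1 C∈ℱ) (≐-trans (γ-cong C≐γA) (γ-comm {A = A} x'≢x))
  where
    x'≢x : x' ≢ x
    x'≢x = distinct-rows (All.lookup fun A∈ℱ) xy∈A (moved⇒∈ A∈ℱ γ'A∉ℱ) xy≢x'y' ∘ sym

Γ-preserves-stable : All Functional ℱ → y' ≢ 1 → Stable x y ℱ → Stable x y (Γ x' y' ℱ)
Γ-preserves-stable {ℱ = ℱ} {y' = y'} {x' = x'} fun y'≢1 stable B∈ xy∈B with Γ-∈⁻ {ℱ = ℱ} B∈
... | A , A∈ℱ , inj₁ (γ'A∈ℱ , refl) =
  Γ-stable-kept {y' = y'} {x' = x'} fun y'≢1 stable A∈ℱ γ'A∈ℱ xy∈B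
... | A , A∈ℱ , inj₂ (γ'A∉ℱ , refl) = Γ-stable-moved fun y'≢1 stable A∈ℱ γ'A∉ℱ xy∈B

Meets : PSet → PSet → Set
Meets A B = ∃ λ p → p ∈ A × p ∈ B

Meets-sym : Meets A B → Meets B A
Meets-sym (p , p∈A , p∈B) = p , p∈B , p∈A

γ-meets : Functional A → y ≢ 1 → (x , y) ∈ A → (∀ {D} → D ∈ 𝒢 → Meets A D) →
          B ∈ 𝒢 → γ x y B ∈ᶠ 𝒢 → Meets (γ x y A) B
γ-meets {A = A} {y = y} {x = x} {B = B} fun y≢1 xy∈A meets B∈𝒢 (D , D∈𝒢 , D≐γB) with meets B∈𝒢
... | p , p∈A , p∈B with p ≟ₚ (x , y)
...   | no p≢xy = p , γ-kept p∈A p≢xy , p∈B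
...   | yes refl with meets D∈𝒢
...     | q , q∈A , q∈D with γ-∈⁻ {A = B} (proj₁ D≐γB q∈D)
...       | inj₁ (refl , _) = ⊥-elim (y≢1 (fun xy∈A q∈A))
...       | inj₂ (q∈B , q≢xy) = q , γ-kept q∈A q≢xy , q∈B

Γ-preserves-cross : All Functional ℱ → All Functional 𝒢 → y ≢ 1 →
                    CrossIntersecting ℱ 𝒢 → CrossIntersecting (Γ x y ℱ) (Γ x y 𝒢)
Γ-preserves-cross {ℱ = ℱ} {𝒢 = 𝒢} {y = y} {x = x} funℱ fun𝒢 y≢1 cross _ _ A'∈ B'∈
  with Γ-∈⁻ {ℱ = ℱ} A'∈ | Γ-∈⁻ {ℱ = 𝒢} B'∈
... | A , A∈ , inj₁ (_ , refl) | B , B∈ , inj₁ (_ , refl) = cross A B A∈ B∈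
... | A , A∈ , inj₂ (γA∉ , refl) | B , B∈ , inj₂ (γB∉ , refl) =
  (x , 1) , γ-shifted (moved⇒∈ A∈ γA∉) , γ-shifted (moved⇒∈ B∈ γB∉)
... | A , A∈ , inj₂ (γA∉ , refl) | B , B∈ , inj₁ (γB∈ , refl) =
  γ-meets (All.lookup funℱ A∈) y≢1 (moved⇒∈ A∈ γA∉) (cross A _ A∈) B∈ γB∈
... | A , A∈ , inj₁ (γA∈ , refl) | B , B∈ , inj₂ (γB∉ , refl) =
  Meets-sym (γ-meets (All.lookup fun𝒢 B∈) y≢1 (moved⇒∈ B∈ γB∉)
                     (λ D∈ → Meets-sym (cross _ B D∈ B∈)) A∈ γA∈)

shiftAlong : List Pair → Family → Family
shiftAlong L ℱ = foldl (λ 𝒢 p → Γ (proj₁ p) (proj₂ p) 𝒢) ℱ L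

shiftAlong-preserves : ∀ {P : PSet → Set} → (∀ {x y A} → P A → P (γ x y A)) →
                       ∀ L → All P ℱ → All P (shiftAlong L ℱ)
shiftAlong-preserves γ-pres [] = id
shiftAlong-preserves γ-pres ((x , y) ∷ L) = shiftAlong-preserves γ-pres L ∘ Γ-preserves γ-pres

record ShiftInvariant (S : Pair → Set) (ℱ 𝒢 : Family) : Set where
  field
    functionalˡ : All Functional ℱ
    functionalʳ : All Functional 𝒢
    cross : CrossIntersecting ℱ 𝒢
    stable : ∀ {x y} → S (x , y) → Stable x y ℱ

Γ-invariant : ∀ {S} → y ≢ 1 → ShiftInvariant S ℱ 𝒢 →
              ShiftInvariant ((_≡ (x , y)) ∪ S) (Γ x y ℱ) (Γ x y 𝒢)
Γ-invariant y≢1 inv = record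
  { functionalˡ = Γ-preserves γ-functional functionalˡ
  ; functionalʳ = Γ-preserves γ-functional functionalʳ
  ; cross = Γ-preserves-cross functionalˡ functionalʳ y≢1 cross
  ; stable = λ { (inj₁ refl) → Γ-stable y≢1
               ; (inj₂ s) → Γ-preserves-stable functionalˡ y≢1 (stable s) }
  }
  where open ShiftInvariant inv

ShiftInvariant-weaken : ∀ {S T} → (∀ {q} → T q → S q) →
                        ShiftInvariant S ℱ 𝒢 → ShiftInvariant T ℱ 𝒢
ShiftInvariant-weaken T⊆S inv = record
  { functionalˡ = functionalˡ ; functionalʳ = functionalʳ ; cross = cross ; stable = stable ∘ T⊆S }
  where open ShiftInvariant inv

shiftAlong-invariant : ∀ {S} L → (∀ {x y} → (x , y) ∈ L → y ≢ 1) → ShiftInvariant S ℱ 𝒢 →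
                       ShiftInvariant ((_∈ L) ∪ S) (shiftAlong L ℱ) (shiftAlong L 𝒢)
shiftAlong-invariant [] _ = ShiftInvariant-weaken λ { (inj₂ s) → s }
shiftAlong-invariant {S = S} ((x , y) ∷ L) off-level-one inv =
  ShiftInvariant-weaken reassociate
    (shiftAlong-invariant L (off-level-one ∘ there) (Γ-invariant (off-level-one (here refl)) inv))
  where
    reassociate : ∀ {q} → q ∈ (x , y) ∷ L ⊎ S q → q ∈ L ⊎ (q ≡ (x , y) ⊎ S q)
    reassociate (inj₁ (here q≡xy)) = inj₂ (inj₁ q≡xy)
    reassociate (inj₁ (there q∈L)) = inj₁ q∈L
    reassociate (inj₂ s) = inj₂ (inj₂ s)

γAlong : List Pair → PSet → PSet
γAlong L C = foldl (λ D p → γ (proj₁ p) (proj₂ p) D) C L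

γAlong-∈ᶠ : ∀ L → (∀ {x y} → (x , y) ∈ L → Stable x y ℱ) → C ∈ᶠ ℱ → γAlong L C ∈ᶠ ℱ
γAlong-∈ᶠ [] _ C∈ℱ = C∈ℱ
γAlong-∈ᶠ ((x , y) ∷ L) stable C∈ℱ =
  γAlong-∈ᶠ L (stable ∘ there) (Stable-∈ᶠ (stable (here refl)) C∈ℱ)

γAlong-∈⁻ : ∀ L C → p ∈ γAlong L C →
            (p ∈ C × p ∉ L) ⊎ ∃₂ λ x y → (x , y) ∈ L × p ≡ (x , 1)
γAlong-∈⁻ [] C p∈C = inj₁ (p∈C , λ ())
γAlong-∈⁻ ((x , y) ∷ L) C p∈ with γAlong-∈⁻ L (γ x y C) p∈
... | inj₂ (x' , y' , x'y'∈L , refl) = inj₂ (x' , y' , there x'y'∈L , refl)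
... | inj₁ (p∈γC , p∉L) with γ-∈⁻ {A = C} p∈γC
...   | inj₁ (refl , _) = inj₂ (x , y , here refl , refl)
...   | inj₂ (p∈C , p≢xy) =
  inj₁ (p∈C , λ { (here p≡xy) → p≢xy p≡xy ; (there p∈L) → p∉L p∈L })

meets-on-level-one : CrossIntersecting ℱ 𝒢 → A ∈ ℱ → B ∈ 𝒢 → Functional B →
                     (∀ {x a} → (x , a) ∈ A → a ≢ 1 → Stable x a ℱ) →
                     ∃ λ x → (x , 1) ∈ A × (x , 1) ∈ B
meets-on-level-one {A = A} {B = B} cross A∈ℱ B∈𝒢 funB stable =
  let D , D∈ℱ , D≐A' = γAlong-∈ᶠ L stableL (∈⇒∈ᶠ A∈ℱ)
  in on-level-one D≐A' (cross D B D∈ℱ B∈𝒢)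
  where
    shift? = λ (q : Pair) → (q ∈? B) ×-dec ¬? (proj₂ q ≟ 1)
    L = filter shift? A
    stableL : ∀ {x y} → (x , y) ∈ L → Stable x y _
    stableL xy∈L = let xy∈A , _ , y≢1 = ∈-filter⁻ shift? {xs = A} xy∈L in stable xy∈A y≢1
    on-level-one : ∀ {D} → D ≐ γAlong L A → Meets D B → ∃ λ x → (x , 1) ∈ A × (x , 1) ∈ B
    on-level-one D≐A' ((x , a) , p∈D , p∈B) with γAlong-∈⁻ L A (proj₁ D≐A' p∈D)
    ... | inj₂ (_ , _ , xy∈L , refl) =
      let _ , xy∈B , y≢1 = ∈-filter⁻ shift? {xs = A} xy∈L in ⊥-elim (y≢1 (funB xy∈B p∈B))
    ... | inj₁ (p∈A , p∉L) with a ≟ 1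
    ...   | yes refl = x , p∈A , p∈B
    ...   | no a≢1 = ⊥-elim (p∉L (∈-filter⁺ shift? p∈A (p∈B , a≢1)))

∈-interval⁺ : a ≤ i → i ≤ b → i ∈ interval a b
∈-interval⁺ {a = a} {i = i} {b = b} a≤i i≤b = subst (_∈ interval a b) (m+[n∸m]≡n a≤i)
  (∈-map⁺ (a +_) (∈-upTo⁺ (∸-monoˡ-< (s≤s i≤b) a≤i)))

∈-interval⁻ : i ∈ interval a b → a ≤ i
∈-interval⁻ {a = a} i∈ with ∈-map⁻ _ i∈
... | k , _ , refl = m≤m+n a k

∈-shiftOrder⁺ : ∀ {l h} → 1 ≤ x → x ≤ l → 2 ≤ y → y ≤ h → (x , y) ∈ shiftOrder l h
∈-shiftOrder⁺ 1≤x x≤l 2≤y y≤h =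
  ∈-concat⁺′ (∈-map⁺ _ (∈-interval⁺ 2≤y y≤h)) (∈-map⁺ _ (∈-interval⁺ 1≤x x≤l))

∈-shiftOrder⁻ : ∀ l h → (x , y) ∈ shiftOrder l h → 2 ≤ y
∈-shiftOrder⁻ l h xy∈ with ∈-concat⁻′ (map (λ x → map (x ,_) (interval 2 h)) (interval 1 l)) xy∈
... | _ , xy∈row , row∈ with ∈-map⁻ _ row∈
...   | _ , _ , refl with ∈-map⁻ _ xy∈row
...     | _ , y∈ , refl = ∈-interval⁻ {b = h} y∈

nth-≤-last : Sorted ≤-totalOrder c → 1 ≤ i → i ≤ length c → nth c i ≤ nth c (length c)
nth-≤-last {c = _ ∷ []} {i = suc zero} _ _ _ = ≤-refl
nth-≤-last {c = _ ∷ []} {i = suc (suc _)} _ _ (s≤s ())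
nth-≤-last {c = _ ∷ _ ∷ _} {i = suc zero} (a≤b ∷ sorted) _ _ =
  ≤-trans a≤b (nth-≤-last sorted (s≤s z≤n) (s≤s z≤n))
nth-≤-last {c = _ ∷ _ ∷ _} {i = suc (suc _)} (_ ∷ sorted) _ (s≤s i≤n) =
  nth-≤-last sorted (s≤s z≤n) i≤n

Bounded⇒∈-shiftOrder : ∀ {m k} → Sorted ≤-totalOrder c → Bounded c A → (x , a) ∈ A → a ≢ 1 →
                       (x , a) ∈ shiftOrder (length c ⊔ m) (nth c (length c) ⊔ k)
Bounded⇒∈-shiftOrder sorted bounded xa∈A a≢1 =
  let (1≤x , x≤n) , 1≤a , a≤cₓ = bounded xa∈A
  in ∈-shiftOrder⁺ 1≤x (≤-trans x≤n (m≤m⊔n _ _)) (≤∧≢⇒< 1≤a (a≢1 ∘ sym))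
       (≤-trans a≤cₓ (≤-trans (nth-≤-last sorted 1≤x x≤n) (m≤m⊔n _ _)))

inL≤⇒Functional : ∀ {r} → inL≤ c r A → Functional A
inL≤⇒Functional (_ , _ , _ , _ , functional) = functional _ _ _

inL≤⇒Bounded : ∀ {r} → inL≤ c r A → Bounded c A
inL≤⇒Bounded (_ , _ , _ , bounded , _) = bounded _ _

corollary4p2 : (c d : List ℕ) → IP c → IP d →
    (𝒜 ℬ : Family) →
    All (inL≤ c (length c)) 𝒜 → All (inL≤ d (length d)) ℬ →
    CrossIntersecting 𝒜 ℬ →
    let l = length c ⊔ length d
        h = nth c (length c) ⊔ nth d (length d)
    in ∀ A B → A ∈ shiftAll l h 𝒜 → B ∈ shiftAll l h ℬ →
       ∃ λ x → (1 ≤ x × x ≤ l) × (x , 1) ∈ A × (x , 1) ∈ B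
corollary4p2 c d (_ , _ , sorted) _ 𝒜 ℬ 𝒜⊆L ℬ⊆L cross A B A∈ B∈ =
  let x , x1∈A , x1∈B = meets-on-level-one cross* A∈ B∈ (All.lookup functional-ℬ* B∈) stable-on-A
      (1≤x , x≤m) , _ = All.lookup bounded-𝒜* A∈ x1∈A
  in x , (1≤x , ≤-trans x≤m (m≤m⊔n _ _)) , x1∈A , x1∈B
  where
    l = length c ⊔ length d
    h = nth c (length c) ⊔ nth d (length d)
    initially : ShiftInvariant ∅ 𝒜 ℬ
    initially = record
      { functionalˡ = All.map (inL≤⇒Functional {c = c}) 𝒜⊆L
      ; functionalʳ = All.map (inL≤⇒Functional {c = d}) ℬ⊆L
      ; cross = cross
      ; stable = λ () }
    open ShiftInvariant (shiftAlong-invariant (shiftOrder l h) (>⇒≢ ∘ ∈-shiftOrder⁻ l h) initially)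
      renaming (cross to cross*; functionalʳ to functional-ℬ*)
    bounded-𝒜* : All (Bounded c) (shiftAll l h 𝒜)
    bounded-𝒜* =
      shiftAlong-preserves (γ-bounded {c = c}) (shiftOrder l h) (All.map (inL≤⇒Bounded {c = c}) 𝒜⊆L)
    stable-on-A : ∀ {x a} → (x , a) ∈ A → a ≢ 1 → Stable x a (shiftAll l h 𝒜)
    stable-on-A xa∈A a≢1 =
      stable (inj₁ (Bounded⇒∈-shiftOrder sorted (All.lookup bounded-𝒜* A∈) xa∈A a≢1))
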